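{- For every $k\in\mathbb{N}$ and $t\in T$, in the supertile $\sigma^k(t)$ all corners of tiles that meet at the same point hold the same value.
   Context: Let $p$ be an odd prime and $\mathbb{F}_p$ the field with $p$ elements. A tile is a unit equilateral triangle of the standard triangular lattice, oriented upward or downward, whose corners are decorated with elements of $\mathbb{F}_p$. $\triangle(x,y,z)$ is the upward tile with bottom-left, bottom-right, top corners $x,y,z$; $\triangledown(x,y,z)$ the downward tile with top-right, top-left, bottom corners $x,y,z$; $T$ is the set of all such tiles. The substitution $\sigma$ inflates a tile by factor $2$ and replaces it by four unit tiles: $\sigma(\triangle(x,y,z))$ consists of bottom-left $\triangle(x,x+y,x+z)$, bottom-right $\triangle(x+y,y,y+z)$, top $\triangle(x+z,y+z,z)$ and central $\triangledown(y+z,x+z,x+y)$; $\sigma(\triangledown(x,y,z))$ consists of top-right $\triangledown(x,x+y,x+z)$, top-left $\triangledown(x+y,y,y+z)$, bottom $\triangledown(x+z,y+z,z)$ and central $\triangle(y+z,x+z,x+y)$. $\sigma$ acts on patches tile by tile; $\sigma^k(t)$ is a triangle of side $2^k$ made of $4^k$ decorated unit tiles. -}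

module Defs where

open import Data.Nat using (ℕ; zero; suc; _+_; _*_; NonZero)
open import Data.Nat.DivMod using (_mod_)
open import Data.Fin using (Fin; toℕ)
open import Data.Product using (_×_; _,_)
open import Data.List using (List; []; _∷_; concatMap)

𝔽 : (p : ℕ) → Set
𝔽 p = Fin p

addF : (p : ℕ) .{{_ : NonZero p}} → 𝔽 p → 𝔽 p → 𝔽 p
addF p x y = (toℕ x + toℕ y) mod p

-- Tiles: △ x y z = upward tile, corners (bottom-left, bottom-right, top);
--        ▽ x y z = downward tile, corners (top-right, top-left, bottom).
data Tile (p : ℕ) : Set where
  △ : 𝔽 p → 𝔽 p → 𝔽 p → Tile p
  ▽ : 𝔽 p → 𝔽 p → 𝔽 p → Tile p

-- Lattice points of the triangular lattice: (a , b) denotes a·e₁ + b·e₂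
-- with e₁ = (1,0), e₂ = (1/2, √3/2).
Point : Set
Point = ℕ × ℕ

-- A placed tile: anchor (a , b) plus decorated tile.
--   upward   at (a,b): vertices (a,b) (a+1,b) (a,b+1)         [bl, br, top]
--   downward at (a,b): vertices (a+1,b+1) (a,b+1) (a+1,b)     [tr, tl, bottom]
record Placed (p : ℕ) : Set where
  constructor place
  field
    anchor : Point
    tile   : Tile p

open Placed public

cornerPos : {p : ℕ} → Placed p → Fin 3 → Point
cornerPos (place (a , b) (△ _ _ _)) Fin.zero = (a , b)
cornerPos (place (a , b) (△ _ _ _)) (Fin.suc Fin.zero) = (suc a , b)
cornerPos (place (a , b) (△ _ _ _)) (Fin.suc (Fin.suc Fin.zero)) = (a , suc b)
cornerPos (place (a , b) (▽ _ _ _)) Fin.zero = (suc a , suc b)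
cornerPos (place (a , b) (▽ _ _ _)) (Fin.suc Fin.zero) = (a , suc b)
cornerPos (place (a , b) (▽ _ _ _)) (Fin.suc (Fin.suc Fin.zero)) = (suc a , b)

cornerVal : {p : ℕ} → Placed p → Fin 3 → 𝔽 p
cornerVal (place _ (△ x y z)) Fin.zero = x
cornerVal (place _ (△ x y z)) (Fin.suc Fin.zero) = y
cornerVal (place _ (△ x y z)) (Fin.suc (Fin.suc Fin.zero)) = z
cornerVal (place _ (▽ x y z)) Fin.zero = x
cornerVal (place _ (▽ x y z)) (Fin.suc Fin.zero) = y
cornerVal (place _ (▽ x y z)) (Fin.suc (Fin.suc Fin.zero)) = z

σ₁ : (p : ℕ) .{{_ : NonZero p}} → Placed p → List (Placed p)
σ₁ p (place (a , b) (△ x y z)) =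
    place (2 * a , 2 * b)         (△ x (x ⊕ y) (x ⊕ z))          -- bottom-left
  ∷ place (suc (2 * a) , 2 * b)   (△ (x ⊕ y) y (y ⊕ z))          -- bottom-right
  ∷ place (2 * a , suc (2 * b))   (△ (x ⊕ z) (y ⊕ z) z)          -- top
  ∷ place (2 * a , 2 * b)         (▽ (y ⊕ z) (x ⊕ z) (x ⊕ y))    -- central
  ∷ []
  where _⊕_ = addF p
σ₁ p (place (a , b) (▽ x y z)) =
    place (suc (2 * a) , suc (2 * b)) (▽ x (x ⊕ y) (x ⊕ z))      -- top-right
  ∷ place (2 * a , suc (2 * b))       (▽ (x ⊕ y) y (y ⊕ z))      -- top-left
  ∷ place (suc (2 * a) , 2 * b)       (▽ (x ⊕ z) (y ⊕ z) z)      -- bottom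
  ∷ place (suc (2 * a) , suc (2 * b)) (△ (y ⊕ z) (x ⊕ z) (x ⊕ y)) -- central
  ∷ []
  where _⊕_ = addF p

σ : (p : ℕ) .{{_ : NonZero p}} → List (Placed p) → List (Placed p)
σ p = concatMap (σ₁ p)

σ^ : (p : ℕ) .{{_ : NonZero p}} → ℕ → List (Placed p) → List (Placed p)
σ^ p zero P = P
σ^ p (suc k) P = σ p (σ^ p k P)

supertile : (p : ℕ) .{{_ : NonZero p}} → ℕ → Tile p → List (Placed p)
supertile p k t = σ^ p k (place (0 , 0) t ∷ [])

-- Label every lattice point by a single function V. If every tile of a patch agrees with V
-- at its corners, then every tile of the inflated patch agrees with the refined labelling
-- that keeps V on the doubled vertices and puts V u ⊕ V w on the midpoint of each edge uw:
-- this is exactly how σ decorates the four children of a tile. The supertile is then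
-- labelled by a function of the point alone, so coinciding corners carry equal values.
module Submission where

open import Defs
open import Data.Nat using (ℕ; NonZero; _%_; zero; suc; _*_)
open import Data.Nat.DivMod using (_mod_)
open import Data.Nat.Primality using (Prime)
open import Data.Nat.Properties using (+-comm; *-suc)
open import Data.Bool using (Bool; true; false)
open import Data.Product using (_×_; _,_; map₁)
open import Data.Fin using (Fin; toℕ)
open import Function using (_∘_)
import Data.Fin as Fin
open import Data.List using ([]; _∷_)
open import Data.List.Membership.Propositional using (_∈_)
open import Data.List.Relation.Unary.All as All using (All; []; _∷_)
open import Data.List.Relation.Unary.All.Properties using (map⁺; concat⁺)
open import Relation.Binary.PropositionalEquality using (_≡_; refl; sym; trans; cong; cong₂)
open import Relation.Binary.PropositionalEquality.Properties using (module ≡-Reasoning)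

halve : ℕ → ℕ × Bool
halve zero = (0 , false)
halve (suc zero) = (0 , true)
halve (suc (suc n)) = map₁ suc (halve n)

halve-2* : ∀ a → halve (2 * a) ≡ (a , false)
halve-2* zero = refl
halve-2* (suc a) = trans (cong halve (*-suc 2 a)) (cong (map₁ suc) (halve-2* a))

halve-1+2* : ∀ a → halve (suc (2 * a)) ≡ (a , true)
halve-1+2* zero = refl
halve-1+2* (suc a) = trans (cong (halve ∘ suc) (*-suc 2 a)) (cong (map₁ suc) (halve-1+2* a))

halve-2+2* : ∀ a → halve (suc (suc (2 * a))) ≡ (suc a , false)
halve-2+2* a = cong (map₁ suc) (halve-2* a)

module _ (p : ℕ) {{_ : NonZero p}} where

  infixl 6 _⊕_
  _⊕_ : 𝔽 p → 𝔽 p → 𝔽 p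
  _⊕_ = addF p

  ⊕-comm : ∀ x y → x ⊕ y ≡ y ⊕ x
  ⊕-comm x y = cong (_mod p) (+-comm (toℕ x) (toℕ y))

  Labelling : Set
  Labelling = Point → 𝔽 p

  record Agrees (V : Labelling) (P : Placed p) : Set where
    constructor agrees
    field
      corner₀ : cornerVal P Fin.zero ≡ V (cornerPos P Fin.zero)
      corner₁ : cornerVal P (Fin.suc Fin.zero) ≡ V (cornerPos P (Fin.suc Fin.zero))
      corner₂ : cornerVal P (Fin.suc (Fin.suc Fin.zero)) ≡ V (cornerPos P (Fin.suc (Fin.suc Fin.zero)))

  Agrees⇒cornerVal≡ : ∀ {V P} → Agrees V P → ∀ i → cornerVal P i ≡ V (cornerPos P i)
  Agrees⇒cornerVal≡ (agrees e₀ e₁ e₂) Fin.zero = e₀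
  Agrees⇒cornerVal≡ (agrees e₀ e₁ e₂) (Fin.suc Fin.zero) = e₁
  Agrees⇒cornerVal≡ (agrees e₀ e₁ e₂) (Fin.suc (Fin.suc Fin.zero)) = e₂

  -- Label of the refined point (2a + r , 2b + s): a vertex, or the midpoint of a
  -- horizontal, vertical or diagonal edge of the original lattice.
  refinedLabel : Labelling → ℕ × Bool → ℕ × Bool → 𝔽 p
  refinedLabel V (a , false) (b , false) = V (a , b)
  refinedLabel V (a , true)  (b , false) = V (a , b) ⊕ V (suc a , b)
  refinedLabel V (a , false) (b , true)  = V (a , b) ⊕ V (a , suc b)
  refinedLabel V (a , true)  (b , true)  = V (suc a , b) ⊕ V (a , suc b)

  -- Opaque, so that refine V (m , n) is not unfolded and refine-at can read m and n off the goal.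
  opaque
    refine : Labelling → Labelling
    refine V (m , n) = refinedLabel V (halve m) (halve n)

    refine-at : ∀ V {m n hm hn} → halve m ≡ hm → halve n ≡ hn →
                refine V (m , n) ≡ refinedLabel V hm hn
    refine-at V = cong₂ (refinedLabel V)

  σ₁-agrees : ∀ V P → Agrees V P → All (Agrees (refine V)) (σ₁ p P)
  σ₁-agrees V (place (a , b) (△ x y z)) (agrees gx gy gz) =
      agrees v₀ m₀₁ m₀₂ ∷ agrees m₀₁ v₁ m₁₂ ∷ agrees m₀₂ m₁₂ v₂ ∷ agrees m₁₂ m₀₂ m₀₁ ∷ []
    where
    v₀ : x ≡ refine V (2 * a , 2 * b)
    v₀ = trans gx (sym (refine-at V (halve-2* a) (halve-2* b)))
    v₁ : y ≡ refine V (suc (suc (2 * a)) , 2 * b)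
    v₁ = trans gy (sym (refine-at V (halve-2+2* a) (halve-2* b)))
    v₂ : z ≡ refine V (2 * a , suc (suc (2 * b)))
    v₂ = trans gz (sym (refine-at V (halve-2* a) (halve-2+2* b)))
    m₀₁ : x ⊕ y ≡ refine V (suc (2 * a) , 2 * b)
    m₀₁ = trans (cong₂ _⊕_ gx gy) (sym (refine-at V (halve-1+2* a) (halve-2* b)))
    m₀₂ : x ⊕ z ≡ refine V (2 * a , suc (2 * b))
    m₀₂ = trans (cong₂ _⊕_ gx gz) (sym (refine-at V (halve-2* a) (halve-1+2* b)))
    m₁₂ : y ⊕ z ≡ refine V (suc (2 * a) , suc (2 * b))
    m₁₂ = trans (cong₂ _⊕_ gy gz) (sym (refine-at V (halve-1+2* a) (halve-1+2* b)))
  σ₁-agrees V (place (a , b) (▽ x y z)) (agrees gx gy gz) =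
      agrees v₀ m₀₁ m₀₂ ∷ agrees m₀₁ v₁ m₁₂ ∷ agrees m₀₂ m₁₂ v₂ ∷ agrees m₁₂ m₀₂ m₀₁ ∷ []
    where
    -- Here the refined labelling adds the corner values in the opposite order.
    v₀ : x ≡ refine V (suc (suc (2 * a)) , suc (suc (2 * b)))
    v₀ = trans gx (sym (refine-at V (halve-2+2* a) (halve-2+2* b)))
    v₁ : y ≡ refine V (2 * a , suc (suc (2 * b)))
    v₁ = trans gy (sym (refine-at V (halve-2* a) (halve-2+2* b)))
    v₂ : z ≡ refine V (suc (suc (2 * a)) , 2 * b)
    v₂ = trans gz (sym (refine-at V (halve-2+2* a) (halve-2* b)))
    m₀₁ : x ⊕ y ≡ refine V (suc (2 * a) , suc (suc (2 * b)))
    m₀₁ = trans (⊕-comm x y) (trans (cong₂ _⊕_ gy gx)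
            (sym (refine-at V (halve-1+2* a) (halve-2+2* b))))
    m₀₂ : x ⊕ z ≡ refine V (suc (suc (2 * a)) , suc (2 * b))
    m₀₂ = trans (⊕-comm x z) (trans (cong₂ _⊕_ gz gx)
            (sym (refine-at V (halve-2+2* a) (halve-1+2* b))))
    m₁₂ : y ⊕ z ≡ refine V (suc (2 * a) , suc (2 * b))
    m₁₂ = trans (⊕-comm y z) (trans (cong₂ _⊕_ gz gy)
            (sym (refine-at V (halve-1+2* a) (halve-1+2* b))))

  σ-agrees : ∀ V {L} → All (Agrees V) L → All (Agrees (refine V)) (σ p L)
  σ-agrees V = concat⁺ ∘ map⁺ ∘ All.map (σ₁-agrees V _)

  tileLabelling : Tile p → Labelling
  tileLabelling (△ x y z) (1 , 0) = y
  tileLabelling (△ x y z) (0 , 1) = z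
  tileLabelling (△ x y z) _ = x
  tileLabelling (▽ x y z) (0 , 1) = y
  tileLabelling (▽ x y z) (1 , 0) = z
  tileLabelling (▽ x y z) _ = x

  tileLabelling-agrees : ∀ t → Agrees (tileLabelling t) (place (0 , 0) t)
  tileLabelling-agrees (△ x y z) = agrees refl refl refl
  tileLabelling-agrees (▽ x y z) = agrees refl refl refl

  supertileLabelling : ℕ → Tile p → Labelling
  supertileLabelling zero t = tileLabelling t
  supertileLabelling (suc k) t = refine (supertileLabelling k t)

  supertile-agrees : ∀ k t → All (Agrees (supertileLabelling k t)) (supertile p k t)
  supertile-agrees zero t = tileLabelling-agrees t ∷ []
  supertile-agrees (suc k) t = σ-agrees (supertileLabelling k t) (supertile-agrees k t)

  supertile-cornerVal : ∀ k t {P} → P ∈ supertile p k t →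
                        ∀ i → cornerVal P i ≡ supertileLabelling k t (cornerPos P i)
  supertile-cornerVal k t P∈ = Agrees⇒cornerVal≡ (All.lookup (supertile-agrees k t) P∈)

mainTheorem13 : (p : ℕ) {{_ : NonZero p}} → Prime p → p % 2 ≡ 1 →
    (k : ℕ) (t : Tile p) (P Q : Placed p) (i j : Fin 3) →
    P ∈ supertile p k t → Q ∈ supertile p k t →
    cornerPos P i ≡ cornerPos Q j → cornerVal P i ≡ cornerVal Q j
mainTheorem13 p _ _ k t P Q i j P∈ Q∈ samePos = begin
  cornerVal P i        ≡⟨ supertile-cornerVal p k t P∈ i ⟩
  V (cornerPos P i)    ≡⟨ cong V samePos ⟩
  V (cornerPos Q j)    ≡⟨ supertile-cornerVal p k t Q∈ j ⟨
  cornerVal Q j        ∎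
  where
  open ≡-Reasoning
  V : Labelling p
  V = supertileLabelling p k t
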